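{- Let $k\ge 1$ and let the vertices of the path $P_{3k}$ be labeled $1,2,\ldots,3k$ consecutively along the path. Then for each vertex $v$, $DV_{P_{3k}}(v)=0$ if $v\equiv 0$ or $1\pmod 3$, and $DV_{P_{3k}}(v)=1$ if $v\equiv 2\pmod 3$.
   Context: All graphs are finite, simple and undirected. A set $D\subseteq V(G)$ is a dominating set of $G$ if every vertex not in $D$ is adjacent to at least one vertex of $D$. The domination number $\gamma(G)$ is the minimum cardinality of a dominating set; a dominating set of cardinality $\gamma(G)$ is a $\gamma(G)$-set. For $v\in V(G)$, $DV_G(v)$ is the number of $\gamma(G)$-sets containing $v$. -}

module Defs where

open import Data.Nat using (ℕ; zero; suc; _+_; _⊓_)
open import Data.Nat.Properties using (_≟_)
open import Data.Fin using (Fin; toℕ)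
open import Data.Fin.Subset using (Subset; _∈_; ∣_∣)
open import Data.Fin.Subset.Properties using (_∈?_)
open import Data.Fin.Properties using (all?; any?)
open import Data.Vec using (_∷_; [])
open import Data.Bool using (true; false)
open import Data.List using (List; []; _∷_; map; filter; length; foldr; _++_)
open import Data.Product using (_×_; _,_; ∃)
open import Data.Sum using (_⊎_)
open import Relation.Nullary using (¬_; Dec)
open import Relation.Nullary.Decidable using (_×-dec_; _⊎-dec_)
open import Relation.Binary using (Decidable)
open import Relation.Binary.PropositionalEquality using (_≡_)

record Graph (n : ℕ) : Set₁ where
  field
    Adj     : Fin n → Fin n → Set
    adj?    : Decidable Adj
    symm    : ∀ {u v} → Adj u v → Adj v u
    irrefl  : ∀ {u} → ¬ Adj u u
open Graph public

IsDominating : ∀ {n} → Graph n → Subset n → Set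
IsDominating {n} G D = ∀ (v : Fin n) → ¬ (v ∈ D) → ∃ λ (u : Fin n) → u ∈ D × Adj G u v

isDominating? : ∀ {n} (G : Graph n) (D : Subset n) → Dec (IsDominating G D)
isDominating? G D = all? λ v → dec v
  where
  open import Relation.Nullary.Decidable using (_→-dec_)
  dec : ∀ v → Dec (¬ (v ∈ D) → ∃ λ u → u ∈ D × Adj G u v)
  dec v = (¬? (v ∈? D)) →-dec any? (λ u → (u ∈? D) ×-dec adj? G u v)
    where open import Relation.Nullary.Decidable using (¬?)

-- Enumeration of all subsets of Fin n (each exactly once).
allSubsets : (n : ℕ) → List (Subset n)
allSubsets zero = [] ∷ []
allSubsets (suc n) = map (false ∷_) (allSubsets n) ++ map (true ∷_) (allSubsets n)

-- Domination number: minimum cardinality of a dominating set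
-- (the full vertex set is always dominating, so n is a valid starting bound).
γ : ∀ {n} → Graph n → ℕ
γ {n} G = foldr _⊓_ n (map ∣_∣ (filter (isDominating? G) (allSubsets n)))

IsγSet : ∀ {n} → Graph n → Subset n → Set
IsγSet G D = IsDominating G D × ∣ D ∣ ≡ γ G

isγSet? : ∀ {n} (G : Graph n) (D : Subset n) → Dec (IsγSet G D)
isγSet? G D = isDominating? G D ×-dec (∣ D ∣ ≟ γ G)

DV : ∀ {n} → Graph n → Fin n → ℕ
DV {n} G v = length (filter (λ D → isγSet? G D ×-dec (v ∈? D)) (allSubsets n))

-- The path P_n: vertex i : Fin n carries label toℕ i + 1; consecutive labels are adjacent.
PathAdj : ∀ {n} → Fin n → Fin n → Set
PathAdj i j = suc (toℕ i) ≡ toℕ j ⊎ suc (toℕ j) ≡ toℕ i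

Path : (n : ℕ) → Graph n
Path n = record
  { Adj = PathAdj
  ; adj? = λ i j → (suc (toℕ i) ≟ toℕ j) ⊎-dec (suc (toℕ j) ≟ toℕ i)
  ; symm = λ { (inj₁ p) → inj₂ p ; (inj₂ p) → inj₁ p }
  ; irrefl = λ { (inj₁ p) → 1+n≢n p ; (inj₂ p) → 1+n≢n p }
  }
  where
  open import Data.Sum using (inj₁; inj₂)
  open import Data.Nat.Properties using (1+n≢n)

-- A dominating set of P_{3k} must contain a vertex from each of the k disjoint
-- triples {3i+1, 3i+2, 3i+3}, because the middle vertex 3i+2 has all its
-- neighbours inside its triple; hence γ(P_{3k}) = k.  If a dominating set of
-- size k contains the first vertex of a triple, the rest of that triple is
-- empty, so the first vertex of the next triple must be in the set as well, and
-- so on until the last vertex of the path is undominated.  Hence the set of the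
-- middle vertices 2, 5, …, 3k−1 is the unique γ-set, and DV is its indicator.
module Submission where

open import Defs
open import Data.Nat using (ℕ; zero; suc; _+_; _*_; _⊓_; _≤_; _<_; _%_; z≤n; s≤s)
open import Data.Nat.Properties
  using (suc-injective; ≤-refl; ≤-trans; ≤-reflexive; ≤-antisym; ≤⇒≯; <⇒≱; *-comm; m≤n⇒m⊓o≤n; m≤n⇒o⊓m≤n; ⊓-glb)
open import Data.Bool using (Bool; true; false; T; _∨_)
open import Data.Unit using (tt)
open import Data.Fin using (Fin; zero; suc; toℕ)
open import Data.Fin.Subset using (Subset; _∈_; _∉_; ∣_∣; ⊤)
open import Data.Fin.Subset.Properties using (_∈?_; ∈⊤; ∣p∣≤∣x∷p∣; ∣⊤∣≡n)
open import Data.Vec using ([]; _∷_; here; there)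
open import Data.Vec.Properties using (∷-injectiveˡ; ∷-injectiveʳ)
open import Data.List using (List; []; _∷_; map; filter; length; _++_)
open import Data.List.Properties using (filter-++; filter-none; length-++; foldr-preservesᵇ; foldr-preservesᵒ)
open import Data.List.Membership.Propositional using () renaming (_∈_ to _∈ₗ_)
open import Data.List.Membership.Propositional.Properties using (∈-map⁺; ∈-++⁺ˡ; ∈-++⁺ʳ; ∈-filter⁺)
import Data.List.Relation.Unary.All as All
import Data.List.Relation.Unary.All.Properties as All
import Data.List.Relation.Unary.Any as Any
import Data.List.Relation.Unary.Any.Properties as Any
open import Data.Product using (_×_; _,_; ∃)
open import Data.Sum using (_⊎_; inj₁; inj₂)
open import Function.Bundles using (_⇔_; mk⇔; Equivalence)
open import Level using (Level)
open import Relation.Nullary using (¬_; yes; no; contradiction)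
open import Relation.Nullary.Decidable using (_×-dec_)
open import Relation.Unary using (Pred; Decidable)
open import Relation.Binary.PropositionalEquality using (_≡_; _≢_; refl; sym; trans; cong; cong₂; subst)
open Relation.Binary.PropositionalEquality.≡-Reasoning

private
  variable
    ℓ : Level
    n : ℕ

∈-allSubsets : (D : Subset n) → D ∈ₗ allSubsets n
∈-allSubsets [] = Any.here refl
∈-allSubsets (false ∷ D) = ∈-++⁺ˡ (∈-map⁺ (false ∷_) (∈-allSubsets D))
∈-allSubsets {suc n} (true ∷ D) = ∈-++⁺ʳ (map (false ∷_) (allSubsets n)) (∈-map⁺ (true ∷_) (∈-allSubsets D))

module _ {A B : Set} {P : Pred B ℓ} (P? : Decidable P) where

  length-filter-map : (f : A → B) (xs : List A) →
                      length (filter P? (map f xs)) ≡ length (filter (λ x → P? (f x)) xs)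
  length-filter-map f [] = refl
  length-filter-map f (x ∷ xs) with P? (f x)
  ... | yes _ = cong suc (length-filter-map f xs)
  ... | no _ = length-filter-map f xs

count-none : {A : Set} {P : Pred A ℓ} (P? : Decidable P) → (∀ {x} → ¬ P x) →
             (xs : List A) → length (filter P? xs) ≡ 0
count-none P? ¬P xs = cong length (filter-none P? (All.universal (λ _ → ¬P) xs))

count-allSubsets-suc : {P : Pred (Subset (suc n)) ℓ} (P? : Decidable P) →
                       length (filter P? (allSubsets (suc n)))
                       ≡ length (filter (λ D → P? (false ∷ D)) (allSubsets n))
                         + length (filter (λ D → P? (true ∷ D)) (allSubsets n))
count-allSubsets-suc {n} P? = begin
  length (filter P? (map (false ∷_) Ds ++ map (true ∷_) Ds))
    ≡⟨ cong length (filter-++ P? (map (false ∷_) Ds) _) ⟩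
  length (filter P? (map (false ∷_) Ds) ++ filter P? (map (true ∷_) Ds))
    ≡⟨ length-++ (filter P? (map (false ∷_) Ds)) ⟩
  length (filter P? (map (false ∷_) Ds)) + length (filter P? (map (true ∷_) Ds))
    ≡⟨ cong₂ _+_ (length-filter-map P? (false ∷_) Ds) (length-filter-map P? (true ∷_) Ds) ⟩
  length (filter (λ D → P? (false ∷ D)) Ds) + length (filter (λ D → P? (true ∷ D)) Ds) ∎
  where Ds = allSubsets n

count-unique : {P : Pred (Subset n) ℓ} (P? : Decidable P) {S : Subset n} →
               (∀ {D} → P D → D ≡ S) → P S → length (filter P? (allSubsets n)) ≡ 1
count-unique P? {[]} unique PS with P? []
... | yes _ = refl
... | no ¬PS = contradiction PS ¬PS
count-unique P? {false ∷ S} unique PS = trans (count-allSubsets-suc P?) (cong₂ _+_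
  (count-unique (λ D → P? (false ∷ D)) (λ p → ∷-injectiveʳ (unique p)) PS)
  (count-none (λ D → P? (true ∷ D)) (λ p → contradiction (∷-injectiveˡ (unique p)) λ ()) (allSubsets _)))
count-unique P? {true ∷ S} unique PS = trans (count-allSubsets-suc P?) (cong₂ _+_
  (count-none (λ D → P? (false ∷ D)) (λ p → contradiction (∷-injectiveˡ (unique p)) λ ()) (allSubsets _))
  (count-unique (λ D → P? (true ∷ D)) (λ p → ∷-injectiveʳ (unique p)) PS))

module _ (G : Graph n) where

  ⊤-isDominating : IsDominating G ⊤
  ⊤-isDominating v v∉⊤ = contradiction ∈⊤ v∉⊤

  γ≤∣D∣ : {D : Subset n} → IsDominating G D → γ G ≤ ∣ D ∣
  γ≤∣D∣ {D} dom = foldr-preservesᵒ ⊓-≤ n (map ∣_∣ (filter (isDominating? G) (allSubsets n)))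
    (inj₂ (Any.map⁺ (Any.map (λ D≡E → ≤-reflexive (cong ∣_∣ (sym D≡E)))
                             (∈-filter⁺ (isDominating? G) (∈-allSubsets D) dom))))
    where
    ⊓-≤ : ∀ x y → x ≤ ∣ D ∣ ⊎ y ≤ ∣ D ∣ → x ⊓ y ≤ ∣ D ∣
    ⊓-≤ x y (inj₁ x≤) = m≤n⇒m⊓o≤n y x≤
    ⊓-≤ x y (inj₂ y≤) = m≤n⇒o⊓m≤n x y≤

  ≤γ : {k : ℕ} → (∀ {D} → IsDominating G D → k ≤ ∣ D ∣) → k ≤ γ G
  ≤γ {k} bound = foldr-preservesᵇ {P = k ≤_} ⊓-glb
    (subst (k ≤_) (∣⊤∣≡n n) (bound ⊤-isDominating))
    (All.map⁺ (All.map bound (All.all-filter (isDominating? G) (allSubsets n))))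

  module _ {S : Subset n} (unique : ∀ {D} → IsγSet G D → D ≡ S) {v : Fin n} where

    unique-γSet⇒DV≡1 : IsγSet G S → v ∈ S → DV G v ≡ 1
    unique-γSet⇒DV≡1 γS v∈S =
      count-unique (λ D → isγSet? G D ×-dec (v ∈? D)) (λ (γD , _) → unique γD) (γS , v∈S)

    unique-γSet⇒DV≡0 : v ∉ S → DV G v ≡ 0
    unique-γSet⇒DV≡0 v∉S = count-none (λ D → isγSet? G D ×-dec (v ∈? D))
      (λ (γD , v∈D) → v∉S (subst (v ∈_) (unique γD) v∈D)) (allSubsets n)

firstBit : Subset n → Bool
firstBit [] = false
firstBit (x ∷ _) = x

∈⇒firstBit : {D : Subset (suc n)} → zero ∈ D → T (firstBit D)
∈⇒firstBit here = tt

-- In `Covered l D` and `DominatedAfter l D` the flag `l` says whether a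
-- virtual vertex just before the path belongs to D.
Covered : Bool → Subset n → Set
Covered _ [] = Data.Unit.⊤
Covered l (x ∷ D) = T (l ∨ x ∨ firstBit D) × Covered x D

DominatedAfter : Bool → Subset n → Set
DominatedAfter {n} l D = ∀ (v : Fin n) → v ∉ D → (toℕ v ≡ 0 × l ≡ true) ⊎ ∃ λ u → u ∈ D × PathAdj u v

dominatedAfter-head : ∀ l x (D : Subset n) → DominatedAfter l (x ∷ D) → T (l ∨ x ∨ firstBit D)
dominatedAfter-head true _ _ _ = tt
dominatedAfter-head false true _ _ = tt
dominatedAfter-head false false D dom with dom zero (λ ())
... | inj₂ (suc zero , there 1∈D , _) = ∈⇒firstBit 1∈D
... | inj₂ (suc (suc _) , _ , inj₂ ())
... | inj₂ (suc _ , _ , inj₁ ())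
... | inj₂ (zero , () , _)

dominatedAfter-tail : ∀ {l x} {D : Subset n} → DominatedAfter l (x ∷ D) → DominatedAfter x D
dominatedAfter-tail dom v v∉D with dom (suc v) (λ { (there v∈D) → v∉D v∈D })
... | inj₂ (zero , here , inj₁ 1≡v+1) = inj₁ (sym (suc-injective 1≡v+1) , refl)
... | inj₂ (suc u , there u∈D , inj₁ u≡v) = inj₂ (u , u∈D , inj₁ (suc-injective u≡v))
... | inj₂ (suc u , there u∈D , inj₂ v≡u) = inj₂ (u , u∈D , inj₂ (suc-injective v≡u))
... | inj₂ (zero , here , inj₂ ())

dominatedAfter⇒covered : ∀ l (D : Subset n) → DominatedAfter l D → Covered l D
dominatedAfter⇒covered l [] dom = tt
dominatedAfter⇒covered l (x ∷ D) dom =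
  dominatedAfter-head l x D dom , dominatedAfter⇒covered x D (dominatedAfter-tail dom)

covered⇒dominatedAfter : ∀ l (D : Subset n) → Covered l D → DominatedAfter l D
covered⇒dominatedAfter l (true ∷ D) _ zero 0∉D = contradiction here 0∉D
covered⇒dominatedAfter true (false ∷ D) _ zero _ = inj₁ (refl , refl)
covered⇒dominatedAfter false (false ∷ true ∷ D) _ zero _ = inj₂ (suc zero , there here , inj₂ refl)
covered⇒dominatedAfter false (false ∷ false ∷ D) (() , _) zero _
covered⇒dominatedAfter false (false ∷ []) (() , _) zero _
covered⇒dominatedAfter l (x ∷ D) (_ , cov) (suc v) v∉D
  with covered⇒dominatedAfter x D cov v (λ v∈D → v∉D (there v∈D))
... | inj₁ (v≡0 , refl) = inj₂ (zero , here , inj₁ (cong suc (sym v≡0)))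
... | inj₂ (u , u∈D , inj₁ u≡v) = inj₂ (suc u , there u∈D , inj₁ (cong suc u≡v))
... | inj₂ (u , u∈D , inj₂ v≡u) = inj₂ (suc u , there u∈D , inj₂ (cong suc v≡u))

isDominating⇒covered : {D : Subset n} → IsDominating (Path n) D → Covered false D
isDominating⇒covered {D = D} dom = dominatedAfter⇒covered false D (λ v v∉D → inj₂ (dom v v∉D))

covered⇒isDominating : {D : Subset n} → Covered false D → IsDominating (Path n) D
covered⇒isDominating {D = D} cov v v∉D with covered⇒dominatedAfter false D cov v v∉D
... | inj₁ (_ , ())
... | inj₂ neighbour = neighbour

pair-size : ∀ b c (D : Subset n) → T (b ∨ c) → suc ∣ D ∣ ≤ ∣ b ∷ c ∷ D ∣
pair-size true c D _ = s≤s (∣p∣≤∣x∷p∣ c D)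
pair-size false true D _ = ≤-refl

triple-size : ∀ a b c (D : Subset n) → T (a ∨ b ∨ c) → suc ∣ D ∣ ≤ ∣ a ∷ b ∷ c ∷ D ∣
triple-size true b c D _ = s≤s (≤-trans (∣p∣≤∣x∷p∣ c D) (∣p∣≤∣x∷p∣ b (c ∷ D)))
triple-size false b c D t = pair-size b c D t

covered⇒k≤∣D∣ : ∀ k {l} (D : Subset (k * 3)) → Covered l D → k ≤ ∣ D ∣
covered⇒k≤∣D∣ zero D _ = z≤n
covered⇒k≤∣D∣ (suc k) (a ∷ b ∷ c ∷ D) (_ , middle , _ , cov) =
  ≤-trans (s≤s (covered⇒k≤∣D∣ k D cov)) (triple-size a b c D middle)

covered-firstBit⇒k<∣D∣ : ∀ k {l} (D : Subset (k * 3)) → Covered l D → T (firstBit D) → k < ∣ D ∣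
covered-firstBit⇒k<∣D∣ zero [] _ ()
covered-firstBit⇒k<∣D∣ (suc k) (true ∷ true ∷ c ∷ D) (_ , _ , _ , cov) _ =
  s≤s (≤-trans (s≤s (covered⇒k≤∣D∣ k D cov)) (pair-size true c D tt))
covered-firstBit⇒k<∣D∣ (suc k) (true ∷ false ∷ true ∷ D) (_ , _ , _ , cov) _ =
  s≤s (s≤s (covered⇒k≤∣D∣ k D cov))
covered-firstBit⇒k<∣D∣ (suc k) (true ∷ false ∷ false ∷ D) (_ , _ , next , cov) _ =
  s≤s (covered-firstBit⇒k<∣D∣ k D cov next)

-- Indexing by k * 3 rather than 3 * k makes a subset split into triples by
-- pattern matching.
centres : ∀ k → Subset (k * 3)
centres zero = []
centres (suc k) = false ∷ true ∷ false ∷ centres k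

∣centres∣ : ∀ k → ∣ centres k ∣ ≡ k
∣centres∣ zero = refl
∣centres∣ (suc k) = cong suc (∣centres∣ k)

centres-covered : ∀ k → Covered false (centres k)
centres-covered zero = tt
centres-covered (suc k) = tt , tt , tt , centres-covered k

covered-minimal⇒centres : ∀ k (D : Subset (k * 3)) → Covered false D → ∣ D ∣ ≤ k → D ≡ centres k
covered-minimal⇒centres zero [] _ _ = refl
covered-minimal⇒centres (suc k) D@(true ∷ _) cov size =
  contradiction size (<⇒≱ (covered-firstBit⇒k<∣D∣ (suc k) {false} D cov tt))
covered-minimal⇒centres (suc k) (false ∷ true ∷ true ∷ D) (_ , _ , _ , cov) (s≤s size) =
  contradiction size (≤⇒≯ (covered⇒k≤∣D∣ k D cov))
covered-minimal⇒centres (suc k) (false ∷ true ∷ false ∷ D) (_ , _ , _ , cov) (s≤s size) =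
  cong (λ D → false ∷ true ∷ false ∷ D) (covered-minimal⇒centres k D cov size)
covered-minimal⇒centres (suc k) (false ∷ false ∷ _) (() , _)

centres-isDominating : ∀ k → IsDominating (Path (k * 3)) (centres k)
centres-isDominating k = covered⇒isDominating (centres-covered k)

γ-Path : ∀ k → γ (Path (k * 3)) ≡ k
γ-Path k = ≤-antisym
  (subst (γ (Path (k * 3)) ≤_) (∣centres∣ k) (γ≤∣D∣ (Path (k * 3)) (centres-isDominating k)))
  (≤γ (Path (k * 3)) (λ dom → covered⇒k≤∣D∣ k _ (isDominating⇒covered dom)))

centres-isγSet : ∀ k → IsγSet (Path (k * 3)) (centres k)
centres-isγSet k = centres-isDominating k , trans (∣centres∣ k) (sym (γ-Path k))

isγSet⇒centres : ∀ k {D : Subset (k * 3)} → IsγSet (Path (k * 3)) D → D ≡ centres k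
isγSet⇒centres k {D} (dom , ∣D∣≡γ) =
  covered-minimal⇒centres k D (isDominating⇒covered dom) (≤-reflexive (trans ∣D∣≡γ (γ-Path k)))

∈-centres⇔ : ∀ k (v : Fin (k * 3)) → v ∈ centres k ⇔ suc (toℕ v) % 3 ≡ 2
∈-centres⇔ (suc k) zero = mk⇔ (λ ()) (λ ())
∈-centres⇔ (suc k) (suc zero) = mk⇔ (λ _ → refl) (λ _ → there here)
∈-centres⇔ (suc k) (suc (suc zero)) = mk⇔ (λ { (there (there ())) }) (λ ())
-- Here (4 + toℕ v) % 3 and (1 + toℕ v) % 3 are definitionally equal.
∈-centres⇔ (suc k) (suc (suc (suc v))) =
  mk⇔ (λ { (there (there (there v∈))) → to v∈ }) (λ v≡ → there (there (there (from v≡))))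
  where open Equivalence (∈-centres⇔ k v)

DVByResidue : (n : ℕ) → Fin n → Set
DVByResidue n v = ((suc (toℕ v) % 3 ≡ 0 ⊎ suc (toℕ v) % 3 ≡ 1) → DV (Path n) v ≡ 0)
                × (suc (toℕ v) % 3 ≡ 2 → DV (Path n) v ≡ 1)

dvByResidue : ∀ k (v : Fin (k * 3)) → DVByResidue (k * 3) v
dvByResidue k v =
    (λ r → unique-γSet⇒DV≡0 G (isγSet⇒centres k) (λ v∈ → residue≢2 r (to v∈)))
  , (λ r → unique-γSet⇒DV≡1 G (isγSet⇒centres k) (centres-isγSet k) (from r))
  where
  open Equivalence (∈-centres⇔ k v)
  G = Path (k * 3)
  residue≢2 : ∀ {r} → r ≡ 0 ⊎ r ≡ 1 → r ≢ 2
  residue≢2 (inj₁ refl) ()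
  residue≢2 (inj₂ refl) ()

corollary5p2 : (k : ℕ) → 1 ≤ k → (v : Fin (3 * k))
    → ((suc (toℕ v) % 3 ≡ 0 ⊎ suc (toℕ v) % 3 ≡ 1) → DV (Path (3 * k)) v ≡ 0)
    × (suc (toℕ v) % 3 ≡ 2 → DV (Path (3 * k)) v ≡ 1)
corollary5p2 k _ = subst (λ n → (v : Fin n) → DVByResidue n v) (*-comm k 3) (dvByResidue k)
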